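{- For every positive integer $n$ and every polynomial $x(k)\in\mathbb{Z}[k]$, $$\sum_{k=0}^{n-1}\Big[(k+1)^3x(k)-(2k+1)(17k^2+17k+5)x(k-1)+k^3x(k-2)\Big]A_k\equiv 0 \pmod {n^3}.$$
   Context: $A_n=\sum_{k=0}^{n}\binom{n}{k}^2\binom{n+k}{k}^2$ are the Apéry numbers. (The bracketed polynomial is $L^{\ast}(x(k))$ for $L=(k+2)^3\sigma^2-(2k+3)(17k^2+51k+39)\sigma+(k+1)^3$, with $L^{\ast}(x(k))=\sum_i a_i(k-i)x(k-i)$.) -}

module Defs where

open import Data.Nat using (ℕ; zero; suc)
open import Data.Nat.Combinatorics using (_C_)
open import Data.Integer using (ℤ; +_; _+_; _*_; _-_)
open import Data.List using (List; []; _∷_)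
import Data.Nat as ℕ

sumℕ : ℕ → (ℕ → ℕ) → ℕ
sumℕ zero    f = 0
sumℕ (suc n) f = sumℕ n f ℕ.+ f n

sumℤ : ℕ → (ℕ → ℤ) → ℤ
sumℤ zero    f = + 0
sumℤ (suc n) f = sumℤ n f + f n

apery : ℕ → ℕ
apery n = sumℕ (suc n) (λ k → (n C k) ℕ.* (n C k) ℕ.* ((n ℕ.+ k) C k) ℕ.* ((n ℕ.+ k) C k))

-- A polynomial in ℤ[k], given by its coefficient list [c₀, c₁, …] (lowest degree first).
Poly : Set
Poly = List ℤ

eval : Poly → ℤ → ℤ
eval []       t = + 0
eval (c ∷ cs) t = c + t * eval cs t

-- Apéry's numbers satisfy L A = 0 for L = (n+2)³σ² − (2n+3)(17n²+51n+39)σ + (n+1)³, with A₁ = 5 A₀.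
-- For any such sequence a, summation by parts against the adjoint L* collapses Σ_{k≤n} (L* x)(k) a_k
-- to the boundary term (n+1)³ (a_n x(n) − a_{n+1} x(n−1)), which is visibly divisible by (n+1)³.
-- The recurrence is proved by creative telescoping: with b n k = C(n,k) C(n+k,k), applying L to b(·,k)²
-- gives G n (k+1) − G n k for an explicit certificate G. After multiplying by (k+1)⁴, the ratio identities
-- of binomial coefficients express every b involved through b (n+1) (k−1), leaving a polynomial identity.
module Submission where

open import Defs
open import Data.Nat using (ℕ; zero; suc; _!)
import Data.Nat as ℕ
import Data.Nat.Properties as ℕ
open import Data.Nat.Combinatorics using (_C_; nCk≡n!/k![n-k]!; k>n⇒nCk≡0; nCk+nC[k+1]≡[n+1]C[k+1]; k![n∸k]!∣n!)
open import Data.Nat.DivMod using (m/n*n≡m)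
import Data.Nat.Tactic.RingSolver as ℕ-Solver
open import Data.Integer using (ℤ; +_; -_; _+_; _*_; _-_; _^_; 0ℤ)
open import Data.Integer.Properties using (pos-*; *-assoc; *-zeroʳ; +-identityʳ; *-cancelˡ-≡)
open import Data.Integer.Divisibility using (_∣_)
open import Data.Integer.Divisibility.Signed using (∣⇒∣ᵤ; ∣-refl; ∣m⇒∣m*n)
open import Data.Integer.Tactic.RingSolver using (solve-∀)
open import Data.Sum using (inj₁; inj₂)
open import Relation.Binary.PropositionalEquality using (_≡_; refl; sym; trans; cong; cong₂; subst; module ≡-Reasoning)

open ≡-Reasoning

sumℤ-cong : ∀ n {f g : ℕ → ℤ} → (∀ k → f k ≡ g k) → sumℤ n f ≡ sumℤ n g
sumℤ-cong zero    f≗g = refl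
sumℤ-cong (suc n) f≗g = cong₂ _+_ (sumℤ-cong n f≗g) (f≗g n)

sumℤ-telescope : ∀ n (g : ℕ → ℤ) → sumℤ n (λ k → g (suc k) - g k) ≡ g n - g 0
sumℤ-telescope zero    g = sym (cancel (g 0))
  where
  cancel : ∀ x → x - x ≡ 0ℤ
  cancel = solve-∀
sumℤ-telescope (suc n) g = trans (cong (_+ (g (suc n) - g n)) (sumℤ-telescope n g)) (chain (g 0) (g n) (g (suc n)))
  where
  chain : ∀ x y z → (y - x) + (z - y) ≡ z - x
  chain = solve-∀

sumℤ-linear : ∀ n α β γ (f g h : ℕ → ℤ) →
              sumℤ n (λ k → α * f k - β * g k + γ * h k) ≡ α * sumℤ n f - β * sumℤ n g + γ * sumℤ n h
sumℤ-linear zero    α β γ f g h = sym (zeros α β γ)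
  where
  zeros : ∀ α β γ → α * 0ℤ - β * 0ℤ + γ * 0ℤ ≡ 0ℤ
  zeros = solve-∀
sumℤ-linear (suc n) α β γ f g h =
  trans (cong (_+ (α * f n - β * g n + γ * h n)) (sumℤ-linear n α β γ f g h))
        (distrib α β γ (sumℤ n f) (sumℤ n g) (sumℤ n h) (f n) (g n) (h n))
  where
  distrib : ∀ α β γ x y z x′ y′ z′ → α * x - β * y + γ * z + (α * x′ - β * y′ + γ * z′)
                                     ≡ α * (x + x′) - β * (y + y′) + γ * (z + z′)
  distrib = solve-∀

sumℤ-extend : ∀ d m (f : ℕ → ℤ) → (∀ k → m ℕ.≤ k → f k ≡ 0ℤ) → sumℤ (d ℕ.+ m) f ≡ sumℤ m f
sumℤ-extend zero    m f vanish = refl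
sumℤ-extend (suc d) m f vanish = begin
  sumℤ (d ℕ.+ m) f + f (d ℕ.+ m)  ≡⟨ cong (λ t → sumℤ (d ℕ.+ m) f + t) (vanish (d ℕ.+ m) (ℕ.m≤n+m m d)) ⟩
  sumℤ (d ℕ.+ m) f + 0ℤ           ≡⟨ +-identityʳ _ ⟩
  sumℤ (d ℕ.+ m) f                ≡⟨ sumℤ-extend d m f vanish ⟩
  sumℤ m f                        ∎

pos-sumℕ : ∀ n (f : ℕ → ℕ) → + sumℕ n f ≡ sumℤ n (λ k → + f k)
pos-sumℕ zero    f = refl
pos-sumℕ (suc n) f = cong (_+ + f n) (pos-sumℕ n f)

[k+r]Ck*k!*r!≡[k+r]! : ∀ k r → ((k ℕ.+ r) C k) ℕ.* (k ! ℕ.* r !) ≡ (k ℕ.+ r) !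
[k+r]Ck*k!*r!≡[k+r]! k r = begin
    ((k ℕ.+ r) C k) ℕ.* (k ! ℕ.* r !)
  ≡⟨ cong (λ t → ((k ℕ.+ r) C k) ℕ.* (k ! ℕ.* t !)) (ℕ.m+n∸m≡n k r) ⟨
    ((k ℕ.+ r) C k) ℕ.* (k ! ℕ.* (k ℕ.+ r ℕ.∸ k) !)
  ≡⟨ cong (ℕ._* (k ! ℕ.* (k ℕ.+ r ℕ.∸ k) !)) (nCk≡n!/k![n-k]! k≤k+r) ⟩
    (k ℕ.+ r) ! ℕ./ (k ! ℕ.* (k ℕ.+ r ℕ.∸ k) !) ℕ.* (k ! ℕ.* (k ℕ.+ r ℕ.∸ k) !)
  ≡⟨ m/n*n≡m (k![n∸k]!∣n! k≤k+r) ⟩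
    (k ℕ.+ r) ! ∎
  where
  k≤k+r : k ℕ.≤ k ℕ.+ r
  k≤k+r = ℕ.m≤m+n k r
  instance
    denominator≢0 : ℕ.NonZero (k ! ℕ.* (k ℕ.+ r ℕ.∸ k) !)
    denominator≢0 = k ℕ.!* (k ℕ.+ r ℕ.∸ k) !≢0

[1+k]*[1+n]C[1+k]≡[1+n]*nCk : ∀ n k → suc k ℕ.* (suc n C suc k) ≡ suc n ℕ.* (n C k)
[1+k]*[1+n]C[1+k]≡[1+n]*nCk n k with ℕ.≤-<-connex k n
... | inj₂ n<k rewrite k>n⇒nCk≡0 n<k | k>n⇒nCk≡0 (ℕ.s<s n<k) = trans (ℕ.*-zeroʳ (suc k)) (sym (ℕ.*-zeroʳ (suc n)))
... | inj₁ k≤n = subst (λ m → suc k ℕ.* (suc m C suc k) ≡ suc m ℕ.* (m C k)) (ℕ.m+[n∸m]≡n k≤n) (offset (n ℕ.∸ k))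
  where
  regroup : ∀ s c f g → s ℕ.* c ℕ.* (f ℕ.* g) ≡ c ℕ.* (s ℕ.* f ℕ.* g)
  regroup = ℕ-Solver.solve-∀
  offset : ∀ r → suc k ℕ.* (suc (k ℕ.+ r) C suc k) ≡ suc (k ℕ.+ r) ℕ.* ((k ℕ.+ r) C k)
  offset r = ℕ.*-cancelʳ-≡ _ _ (k ! ℕ.* r !) {{k ℕ.!* r !≢0}} (begin
      suc k ℕ.* (suc (k ℕ.+ r) C suc k) ℕ.* (k ! ℕ.* r !)
    ≡⟨ regroup (suc k) (suc (k ℕ.+ r) C suc k) (k !) (r !) ⟩
      (suc (k ℕ.+ r) C suc k) ℕ.* (suc k ! ℕ.* r !)
    ≡⟨ [k+r]Ck*k!*r!≡[k+r]! (suc k) r ⟩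
      suc (k ℕ.+ r) ℕ.* (k ℕ.+ r) !
    ≡⟨ cong (suc (k ℕ.+ r) ℕ.*_) ([k+r]Ck*k!*r!≡[k+r]! k r) ⟨
      suc (k ℕ.+ r) ℕ.* (((k ℕ.+ r) C k) ℕ.* (k ! ℕ.* r !))
    ≡⟨ ℕ.*-assoc (suc (k ℕ.+ r)) ((k ℕ.+ r) C k) (k ! ℕ.* r !) ⟨
      suc (k ℕ.+ r) ℕ.* ((k ℕ.+ r) C k) ℕ.* (k ! ℕ.* r !) ∎)

absorption : ∀ n k → + suc k * + (suc n C suc k) ≡ + suc n * + (n C k)
absorption n k = begin
    + suc k * + (suc n C suc k)     ≡⟨ pos-* (suc k) _ ⟨
    + (suc k ℕ.* (suc n C suc k))   ≡⟨ cong +_ ([1+k]*[1+n]C[1+k]≡[1+n]*nCk n k) ⟩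
    + (suc n ℕ.* (n C k))           ≡⟨ pos-* (suc n) _ ⟩
    + suc n * + (n C k)             ∎

index-step : ∀ n k → + suc k * + (n C suc k) ≡ (+ n - + k) * + (n C k)
index-step n k = begin
    + suc k * + (n C suc k)
  ≡⟨ expand (+ suc k) (+ (n C k)) (+ (n C suc k)) ⟩
    + suc k * (+ (n C k) + + (n C suc k)) - + suc k * + (n C k)
  ≡⟨ cong (λ t → + suc k * + t - + suc k * + (n C k)) (nCk+nC[k+1]≡[n+1]C[k+1] n k) ⟩
    + suc k * + (suc n C suc k) - + suc k * + (n C k)
  ≡⟨ cong (_- + suc k * + (n C k)) (absorption n k) ⟩
    + suc n * + (n C k) - + suc k * + (n C k)
  ≡⟨ collect (+ n) (+ k) (+ (n C k)) ⟩
    (+ n - + k) * + (n C k) ∎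
  where
  expand : ∀ s x y → s * y ≡ s * (x + y) - s * x
  expand = solve-∀
  collect : ∀ N K x → (+ 1 + N) * x - (+ 1 + K) * x ≡ (N - K) * x
  collect = solve-∀

row-step : ∀ n k → (+ suc n - + k) * + (suc n C k) ≡ + suc n * + (n C k)
row-step n k = trans (sym (index-step (suc n) k)) (absorption n k)

b : ℕ → ℕ → ℤ
b n k = + (n C k) * + ((n ℕ.+ k) C k)

b-vanishes : ∀ {n k} → n ℕ.< k → b n k ≡ 0ℤ
b-vanishes {n} {k} n<k = cong (λ t → + t * + ((n ℕ.+ k) C k)) (k>n⇒nCk≡0 n<k)

b-row-step : ∀ n k → (+ suc n - + k) * b (suc n) k ≡ (+ suc n + + k) * b n k
b-row-step n k = begin
    (+ suc n - + k) * (+ (suc n C k) * + (suc (n ℕ.+ k) C k))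
  ≡⟨ *-assoc (+ suc n - + k) _ _ ⟨
    (+ suc n - + k) * + (suc n C k) * + (suc (n ℕ.+ k) C k)
  ≡⟨ cong (_* + (suc (n ℕ.+ k) C k)) (row-step n k) ⟩
    + suc n * + (n C k) * + (suc (n ℕ.+ k) C k)
  ≡⟨ regroup (+ n) (+ k) (+ (n C k)) (+ (suc (n ℕ.+ k) C k)) ⟩
    + (n C k) * ((+ suc (n ℕ.+ k) - + k) * + (suc (n ℕ.+ k) C k))
  ≡⟨ cong (+ (n C k) *_) (row-step (n ℕ.+ k) k) ⟩
    + (n C k) * (+ suc (n ℕ.+ k) * + ((n ℕ.+ k) C k))
  ≡⟨ x∙yz≈y∙xz (+ (n C k)) (+ suc (n ℕ.+ k)) _ ⟩
    (+ suc n + + k) * b n k ∎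
  where
  regroup : ∀ N K x y → (+ 1 + N) * x * y ≡ x * ((+ 1 + (N + K) - K) * y)
  regroup = solve-∀
  x∙yz≈y∙xz : ∀ x y z → x * (y * z) ≡ y * (x * z)
  x∙yz≈y∙xz = solve-∀

b-index-step : ∀ n k → + suc k * + suc k * b n (suc k) ≡ (+ n - + k) * (+ suc n + + k) * b n k
b-index-step n k = begin
    + suc k * + suc k * (+ (n C suc k) * + ((n ℕ.+ suc k) C suc k))
  ≡⟨ cong (λ m → + suc k * + suc k * (+ (n C suc k) * + (m C suc k))) (ℕ.+-suc n k) ⟩
    + suc k * + suc k * (+ (n C suc k) * + (suc (n ℕ.+ k) C suc k))
  ≡⟨ interchange (+ suc k) (+ (n C suc k)) _ ⟩
    (+ suc k * + (n C suc k)) * (+ suc k * + (suc (n ℕ.+ k) C suc k))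
  ≡⟨ cong₂ _*_ (index-step n k) (absorption (n ℕ.+ k) k) ⟩
    ((+ n - + k) * + (n C k)) * (+ suc (n ℕ.+ k) * + ((n ℕ.+ k) C k))
  ≡⟨ interchange′ (+ n - + k) (+ (n C k)) (+ suc (n ℕ.+ k)) _ ⟩
    (+ n - + k) * (+ suc n + + k) * b n k ∎
  where
  interchange : ∀ s x y → s * s * (x * y) ≡ (s * x) * (s * y)
  interchange = solve-∀
  interchange′ : ∀ d x s y → (d * x) * (s * y) ≡ d * s * (x * y)
  interchange′ = solve-∀

b-shift-up : ∀ n i → + suc i * + suc i * b (suc (suc n)) (suc i)
                     ≡ (+ suc (suc (suc n)) + + i) * ((+ suc (suc n) + + i) * b (suc n) i)
b-shift-up n i = begin
    + suc i * + suc i * b (suc (suc n)) (suc i)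
  ≡⟨ b-index-step (suc (suc n)) i ⟩
    (+ suc (suc n) - + i) * (+ suc (suc (suc n)) + + i) * b (suc (suc n)) i
  ≡⟨ regroup (+ suc (suc n) - + i) _ _ ⟩
    (+ suc (suc (suc n)) + + i) * ((+ suc (suc n) - + i) * b (suc (suc n)) i)
  ≡⟨ cong ((+ suc (suc (suc n)) + + i) *_) (b-row-step (suc n) i) ⟩
    (+ suc (suc (suc n)) + + i) * ((+ suc (suc n) + + i) * b (suc n) i) ∎
  where
  regroup : ∀ d s x → d * s * x ≡ s * (d * x)
  regroup = solve-∀

b-shift-down : ∀ n i → + suc i * + suc i * b n (suc i) ≡ (+ n - + i) * ((+ suc n - + i) * b (suc n) i)
b-shift-down n i = begin
    + suc i * + suc i * b n (suc i)
  ≡⟨ b-index-step n i ⟩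
    (+ n - + i) * (+ suc n + + i) * b n i
  ≡⟨ *-assoc (+ n - + i) _ _ ⟩
    (+ n - + i) * ((+ suc n + + i) * b n i)
  ≡⟨ cong ((+ n - + i) *_) (b-row-step n i) ⟨
    (+ n - + i) * ((+ suc n - + i) * b (suc n) i) ∎

middleCoefficient : ℕ → ℤ
middleCoefficient k = + (2 ℕ.* k ℕ.+ 1) * + (17 ℕ.* k ℕ.* k ℕ.+ 17 ℕ.* k ℕ.+ 5)

L : (ℕ → ℤ) → ℕ → ℤ
L a n = (+ suc (suc n)) ^ 3 * a (suc (suc n)) - middleCoefficient (suc n) * a (suc n) + (+ suc n) ^ 3 * a n

-- Found by Zeilberger's algorithm.
certificate : ℕ → ℕ → ℤ
certificate n i = + 4 * (+ 2 * + n + + 3) * ((+ 2 * + n + + 3) * (+ 2 * + n + + 3) - + i * (+ 2 * + i + + 1))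

G : ℕ → ℕ → ℤ
G n zero    = 0ℤ
G n (suc i) = - (certificate n i * (b (suc n) i * b (suc n) i))

-- Stated through the unfoldings + 1 + N of + suc n and N₂ * (N₂ * (N₂ * + 1)) of (+ suc (suc n)) ^ 3,
-- as the ring solver does not handle _^_ and instances then match the goals definitionally.
certificate-identity : ∀ N I e →
  let N₁ = + 1 + N ; N₂ = + 1 + N₁ ; J = + 1 + I
      K : ℤ → ℤ
      K j = + 4 * (+ 2 * N + + 3) * ((+ 2 * N + + 3) * (+ 2 * N + + 3) - j * (+ 2 * j + + 1))
      Y = (N₁ - I) * (N₂ + I) * e
  in N₂ * (N₂ * (N₂ * + 1)) * (((+ 1 + N₂ + I) * ((N₂ + I) * e)) * ((+ 1 + N₂ + I) * ((N₂ + I) * e)))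
     - (+ 2 * N₁ + + 1) * (+ 17 * N₁ * N₁ + + 17 * N₁ + + 5) * (Y * Y)
     + N₁ * (N₁ * (N₁ * + 1)) * (((N - I) * ((N₁ - I) * e)) * ((N - I) * ((N₁ - I) * e)))
   ≡ - (K J * (Y * Y)) + K I * (J * J * (J * J) * (e * e))
certificate-identity = solve-∀

telescope-step : ∀ n k → L (λ m → b m k * b m k) n ≡ G n (suc k) - G n k
telescope-step n zero = initial (+ n)
  where
  initial : ∀ N →
    let N₁ = + 1 + N ; N₂ = + 1 + N₁ in
    N₂ * (N₂ * (N₂ * + 1)) * (+ 1) - (+ 2 * N₁ + + 1) * (+ 17 * N₁ * N₁ + + 17 * N₁ + + 5) * + 1 + N₁ * (N₁ * (N₁ * + 1)) * + 1
      ≡ - (+ 4 * (+ 2 * N + + 3) * ((+ 2 * N + + 3) * (+ 2 * N + + 3) - + 0 * (+ 2 * + 0 + + 1)) * + 1) - + 0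
  initial = solve-∀
telescope-step n (suc i) = *-cancelˡ-≡ (J * J * (J * J)) _ _ (begin
    J * J * (J * J) * L (λ m → b m (suc i) * b m (suc i)) n
  ≡⟨ spread J α β γ (b (suc (suc n)) (suc i)) (b (suc n) (suc i)) (b n (suc i)) ⟩
    α * ((J * J * b (suc (suc n)) (suc i)) * (J * J * b (suc (suc n)) (suc i)))
      - β * ((J * J * b (suc n) (suc i)) * (J * J * b (suc n) (suc i)))
      + γ * ((J * J * b n (suc i)) * (J * J * b n (suc i)))
  ≡⟨ substitute (b-shift-up n i) (b-index-step (suc n) i) (b-shift-down n i) ⟩
    α * (X * X) - β * (Y * Y) + γ * (Z * Z)
  ≡⟨ certificate-identity (+ n) (+ i) e ⟩
    - (certificate n (suc i) * (Y * Y)) + certificate n i * (J * J * (J * J) * (e * e))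
  ≡⟨ cong (λ y → - (certificate n (suc i) * (y * y)) + certificate n i * (J * J * (J * J) * (e * e))) (b-index-step (suc n) i) ⟨
    - (certificate n (suc i) * ((J * J * b (suc n) (suc i)) * (J * J * b (suc n) (suc i))))
      + certificate n i * (J * J * (J * J) * (e * e))
  ≡⟨ gather J (certificate n (suc i)) (certificate n i) (b (suc n) (suc i)) e ⟩
    J * J * (J * J) * (G n (suc (suc i)) - G n (suc i)) ∎)
  where
  J α β γ e X Y Z : ℤ
  J = + suc i
  α = (+ suc (suc n)) ^ 3
  β = middleCoefficient (suc n)
  γ = (+ suc n) ^ 3
  e = b (suc n) i
  X = (+ suc (suc (suc n)) + + i) * ((+ suc (suc n) + + i) * e)
  Y = (+ suc n - + i) * (+ suc (suc n) + + i) * e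
  Z = (+ n - + i) * ((+ suc n - + i) * e)
  spread : ∀ j α β γ x y z → j * j * (j * j) * (α * (x * x) - β * (y * y) + γ * (z * z))
                             ≡ α * ((j * j * x) * (j * j * x)) - β * ((j * j * y) * (j * j * y)) + γ * ((j * j * z) * (j * j * z))
  spread = solve-∀
  substitute : ∀ {x x′ y y′ z z′} → x ≡ x′ → y ≡ y′ → z ≡ z′ →
               α * (x * x) - β * (y * y) + γ * (z * z) ≡ α * (x′ * x′) - β * (y′ * y′) + γ * (z′ * z′)
  substitute refl refl refl = refl
  gather : ∀ j k₁ k₀ y e → - (k₁ * ((j * j * y) * (j * j * y))) + k₀ * (j * j * (j * j) * (e * e))
                          ≡ j * j * (j * j) * (- (k₁ * (y * y)) - - (k₀ * (e * e)))
  gather = solve-∀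

apery≡sum-b² : ∀ d n → + apery n ≡ sumℤ (d ℕ.+ suc n) (λ k → b n k * b n k)
apery≡sum-b² d n = begin
    + apery n
  ≡⟨ pos-sumℕ (suc n) _ ⟩
    sumℤ (suc n) (λ k → + ((n C k) ℕ.* (n C k) ℕ.* ((n ℕ.+ k) C k) ℕ.* ((n ℕ.+ k) C k)))
  ≡⟨ sumℤ-cong (suc n) (λ k → cast (n C k) ((n ℕ.+ k) C k)) ⟩
    sumℤ (suc n) (λ k → b n k * b n k)
  ≡⟨ sumℤ-extend d (suc n) _ (λ k n<k → cong (_* b n k) (b-vanishes n<k)) ⟨
    sumℤ (d ℕ.+ suc n) (λ k → b n k * b n k) ∎
  where
  square : ∀ x y → x ℕ.* x ℕ.* y ℕ.* y ≡ (x ℕ.* y) ℕ.* (x ℕ.* y)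
  square = ℕ-Solver.solve-∀
  cast : ∀ x y → + (x ℕ.* x ℕ.* y ℕ.* y) ≡ (+ x * + y) * (+ x * + y)
  cast x y = trans (cong +_ (square x y))
               (trans (pos-* (x ℕ.* y) (x ℕ.* y)) (cong₂ _*_ (pos-* x y) (pos-* x y)))

apery-recurrence : ∀ n → L (λ m → + apery m) n ≡ 0ℤ
apery-recurrence n = begin
    L (λ m → + apery m) n
  ≡⟨ cong₂ (λ s t → α * s - β * t + γ * + apery n) (apery≡sum-b² 0 (suc (suc n))) (apery≡sum-b² 1 (suc n)) ⟩
    α * sumℤ (3+ n) (F (suc (suc n))) - β * sumℤ (3+ n) (F (suc n)) + γ * + apery n
  ≡⟨ cong (λ u → α * sumℤ (3+ n) (F (suc (suc n))) - β * sumℤ (3+ n) (F (suc n)) + γ * u) (apery≡sum-b² 2 n) ⟩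
    α * sumℤ (3+ n) (F (suc (suc n))) - β * sumℤ (3+ n) (F (suc n)) + γ * sumℤ (3+ n) (F n)
  ≡⟨ sumℤ-linear (3+ n) α β γ (F (suc (suc n))) (F (suc n)) (F n) ⟨
    sumℤ (3+ n) (λ k → L (λ m → F m k) n)
  ≡⟨ sumℤ-cong (3+ n) (telescope-step n) ⟩
    sumℤ (3+ n) (λ k → G n (suc k) - G n k)
  ≡⟨ sumℤ-telescope (3+ n) (G n) ⟩
    - (certificate n (suc (suc n)) * (b (suc n) (suc (suc n)) * b (suc n) (suc (suc n)))) - 0ℤ
  ≡⟨ cong (λ t → - (certificate n (suc (suc n)) * (t * t)) - 0ℤ) (b-vanishes (ℕ.n<1+n (suc n))) ⟩
    - (certificate n (suc (suc n)) * 0ℤ) - 0ℤ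
  ≡⟨ cong (λ t → - t - 0ℤ) (*-zeroʳ (certificate n (suc (suc n)))) ⟩
    0ℤ ∎
  where
  3+_ : ℕ → ℕ
  3+ n = suc (suc (suc n))
  α β γ : ℤ
  α = (+ suc (suc n)) ^ 3
  β = middleCoefficient (suc n)
  γ = (+ suc n) ^ 3
  F : ℕ → ℕ → ℤ
  F m k = b m k * b m k

summation-by-parts-step : ∀ α β γ a₀ a₁ a₂ x₋ x₀ x₁ → α * a₂ - β * a₁ + γ * a₀ ≡ 0ℤ →
       γ * (a₀ * x₀ - a₁ * x₋) + (α * x₁ - β * x₀ + γ * x₋) * a₁ ≡ α * (a₁ * x₁ - a₂ * x₀)
summation-by-parts-step α β γ a₀ a₁ a₂ x₋ x₀ x₁ recurrence = begin
    γ * (a₀ * x₀ - a₁ * x₋) + (α * x₁ - β * x₀ + γ * x₋) * a₁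
  ≡⟨ expand α β γ a₀ a₁ a₂ x₋ x₀ x₁ ⟩
    α * (a₁ * x₁ - a₂ * x₀) + x₀ * (α * a₂ - β * a₁ + γ * a₀)
  ≡⟨ cong (λ t → α * (a₁ * x₁ - a₂ * x₀) + x₀ * t) recurrence ⟩
    α * (a₁ * x₁ - a₂ * x₀) + x₀ * 0ℤ
  ≡⟨ drop (α * (a₁ * x₁ - a₂ * x₀)) x₀ ⟩
    α * (a₁ * x₁ - a₂ * x₀) ∎
  where
  expand : ∀ α β γ a₀ a₁ a₂ x₋ x₀ x₁ →
           γ * (a₀ * x₀ - a₁ * x₋) + (α * x₁ - β * x₀ + γ * x₋) * a₁
           ≡ α * (a₁ * x₁ - a₂ * x₀) + x₀ * (α * a₂ - β * a₁ + γ * a₀)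
  expand = solve-∀
  drop : ∀ y x → y + x * 0ℤ ≡ y
  drop = solve-∀

L* : (ℤ → ℤ) → ℕ → ℤ
L* x k = (+ (k ℕ.+ 1)) ^ 3 * x (+ k) - middleCoefficient k * x (+ k - + 1) + (+ k) ^ 3 * x (+ k - + 2)

sum-L*≡boundary : ∀ {a : ℕ → ℤ} → (∀ n → L a n ≡ 0ℤ) → a 1 ≡ + 5 * a 0 → ∀ (x : ℤ → ℤ) n →
                  sumℤ (suc n) (λ k → L* x k * a k) ≡ (+ suc n) ^ 3 * (a n * x (+ n) - a (suc n) * x (+ n - + 1))
sum-L*≡boundary {a} La≡0 a₁≡5a₀ x zero = begin
    0ℤ + (+ 1 * x (+ 0) - + 5 * x (- + 1) + 0ℤ * x (- + 2)) * a 0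
  ≡⟨ initial (x (+ 0)) (x (- + 1)) (x (- + 2)) (a 0) ⟩
    + 1 * (a 0 * x (+ 0) - + 5 * a 0 * x (- + 1))
  ≡⟨ cong (λ t → + 1 * (a 0 * x (+ 0) - t * x (- + 1))) a₁≡5a₀ ⟨
    + 1 * (a 0 * x (+ 0) - a 1 * x (- + 1)) ∎
  where
  initial : ∀ x₀ x₋₁ x₋₂ a₀ → 0ℤ + (+ 1 * x₀ - + 5 * x₋₁ + 0ℤ * x₋₂) * a₀ ≡ + 1 * (a₀ * x₀ - + 5 * a₀ * x₋₁)
  initial = solve-∀
sum-L*≡boundary {a} La≡0 a₁≡5a₀ x (suc n) = begin
    sumℤ (suc n) (λ k → L* x k * a k) + L* x (suc n) * a (suc n)
  ≡⟨ cong (_+ L* x (suc n) * a (suc n)) (sum-L*≡boundary La≡0 a₁≡5a₀ x n) ⟩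
    γ * (a n * x (+ n) - a (suc n) * x (+ n - + 1)) + L* x (suc n) * a (suc n)
  ≡⟨ cong₂ (λ c y → γ * (a n * x (+ n) - a (suc n) * x (+ n - + 1))
                     + (c * x (+ suc n) - β * x (+ n) + γ * y) * a (suc n))
           (cong (λ m → (+ m) ^ 3) (ℕ.+-comm (suc n) 1)) (cong x (shift (+ n))) ⟩
    γ * (a n * x (+ n) - a (suc n) * x (+ n - + 1))
      + (α * x (+ suc n) - β * x (+ n) + γ * x (+ n - + 1)) * a (suc n)
  ≡⟨ summation-by-parts-step α β γ (a n) (a (suc n)) (a (suc (suc n))) (x (+ n - + 1)) (x (+ n)) (x (+ suc n)) (La≡0 n) ⟩
    α * (a (suc n) * x (+ suc n) - a (suc (suc n)) * x (+ n)) ∎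
  where
  α β γ : ℤ
  α = (+ suc (suc n)) ^ 3
  β = middleCoefficient (suc n)
  γ = (+ suc n) ^ 3
  shift : ∀ N → + 1 + N - + 2 ≡ N - + 1
  shift = solve-∀

corollary3p4 : (n : ℕ) → (x : Poly) →
    (+ (suc n)) ^ 3 ∣ sumℤ (suc n) (λ k →
      ((+ (k Data.Nat.+ 1)) ^ 3 * eval x (+ k)
        - (+ (2 Data.Nat.* k Data.Nat.+ 1)) * (+ (17 Data.Nat.* k Data.Nat.* k Data.Nat.+ 17 Data.Nat.* k Data.Nat.+ 5)) * eval x (+ k - + 1)
        + (+ k) ^ 3 * eval x (+ k - + 2)) * + (apery k))
corollary3p4 n x =
  subst ((+ suc n) ^ 3 ∣_) (sym (sum-L*≡boundary apery-recurrence refl (eval x) n))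
        (∣⇒∣ᵤ (∣m⇒∣m*n (+ apery n * eval x (+ n) - + apery (suc n) * eval x (+ n - + 1)) (∣-refl {(+ suc n) ^ 3})))
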